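{- \begin{enumerate} \item[(i)] $\mathsf I (\leqslant) \nvdash x + y = y + x$, $\mathsf I (\leqslant) \nvdash x \cdot y = y \cdot x$, and $\mathsf I (\leqslant) \nvdash S x \ne x$; \item[(ii)] $\mathsf I (\leqslant) \nvdash \mathsf I (=)$, $\mathsf I (\leqslant) \nvdash \mathsf I (\ne)$, and $\mathsf I (\leqslant) \nvdash \mathsf I (\not\leqslant)$. \end{enumerate}
   Context: $\mathsf Q$ denotes Robinson arithmetic in the language $(0, S, +, \cdot, \leqslant)$ (with $x \leqslant y \leftrightarrow \exists r (r + x = y)$ as an axiom). $\mathsf I(\leqslant)$ is $\mathsf Q$ together with the induction schema for all formulas of the form $t \leqslant s$ ($t,s$ terms, possibly with parameters); $\mathsf I(=)$, $\mathsf I(\ne)$, $\mathsf I(\not\leqslant)$ are defined similarly with induction for formulas $t = s$, $t \ne s$, $\neg(t \leqslant s)$ respectively. -}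

module Defs where

open import Data.Nat using (ℕ; zero; suc)
open import Data.Fin using (Fin; zero; suc)
open import Data.Sum using (_⊎_)

-- Syntax of first-order arithmetic in the language (0, S, +, ·, ≤),
-- with scoped de Bruijn variables: Term n / Formula n have free
-- variables among Fin n (variable zero = most recently bound).

infixl 7 _·'_
infixl 6 _+'_
infix  4 _≐_ _≼_
infixr 2 _⇒_
infixr 3 _∧'_
infix  8 _[_]

data Term (n : ℕ) : Set where
  var  : Fin n → Term n
  zero' : Term n
  S'   : Term n → Term n
  _+'_ : Term n → Term n → Term n
  _·'_ : Term n → Term n → Term n

data Formula (n : ℕ) : Set where
  _≐_ : Term n → Term n → Formula n
  _≼_ : Term n → Term n → Formula n
  ⊥'  : Formula n
  _⇒_ : Formula n → Formula n → Formula n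
  all : Formula (suc n) → Formula n

¬' : ∀ {n} → Formula n → Formula n
¬' φ = φ ⇒ ⊥'

_∧'_ : ∀ {n} → Formula n → Formula n → Formula n
φ ∧' ψ = ¬' (φ ⇒ ¬' ψ)

_⇔_ : ∀ {n} → Formula n → Formula n → Formula n
φ ⇔ ψ = (φ ⇒ ψ) ∧' (ψ ⇒ φ)

ex : ∀ {n} → Formula (suc n) → Formula n
ex φ = ¬' (all (¬' φ))

Ren : ℕ → ℕ → Set
Ren n m = Fin n → Fin m

liftRen : ∀ {n m} → Ren n m → Ren (suc n) (suc m)
liftRen ρ zero    = zero
liftRen ρ (suc i) = suc (ρ i)

renT : ∀ {n m} → Ren n m → Term n → Term m
renT ρ (var i)  = var (ρ i)
renT ρ zero'    = zero'
renT ρ (S' t)   = S' (renT ρ t)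
renT ρ (t +' s) = renT ρ t +' renT ρ s
renT ρ (t ·' s) = renT ρ t ·' renT ρ s

renF : ∀ {n m} → Ren n m → Formula n → Formula m
renF ρ (t ≐ s) = renT ρ t ≐ renT ρ s
renF ρ (t ≼ s) = renT ρ t ≼ renT ρ s
renF ρ ⊥'      = ⊥'
renF ρ (φ ⇒ ψ) = renF ρ φ ⇒ renF ρ ψ
renF ρ (all φ) = all (renF (liftRen ρ) φ)

Sub : ℕ → ℕ → Set
Sub n m = Fin n → Term m

liftSub : ∀ {n m} → Sub n m → Sub (suc n) (suc m)
liftSub σ zero    = var zero
liftSub σ (suc i) = renT suc (σ i)

subT : ∀ {n m} → Sub n m → Term n → Term m
subT σ (var i)  = σ i
subT σ zero'    = zero'
subT σ (S' t)   = S' (subT σ t)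
subT σ (t +' s) = subT σ t +' subT σ s
subT σ (t ·' s) = subT σ t ·' subT σ s

subF : ∀ {n m} → Sub n m → Formula n → Formula m
subF σ (t ≐ s) = subT σ t ≐ subT σ s
subF σ (t ≼ s) = subT σ t ≼ subT σ s
subF σ ⊥'      = ⊥'
subF σ (φ ⇒ ψ) = subF σ φ ⇒ subF σ ψ
subF σ (all φ) = all (subF (liftSub σ) φ)

σ₀ : ∀ {n} → Term n → Sub (suc n) n
σ₀ t zero    = t
σ₀ t (suc i) = var i

_[_] : ∀ {n} → Formula (suc n) → Term n → Formula n
φ [ t ] = subF (σ₀ t) φ

wk : ∀ {n} → Formula n → Formula (suc n)
wk = renF suc

emb : ∀ {n} → Formula 0 → Formula n
emb = renF (λ ())

close : (k : ℕ) → Formula k → Formula 0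
close zero    φ = φ
close (suc k) φ = close k (all φ)

-- Classical first-order Hilbert calculus with equality.
-- A theory is a set of sentences; T ⊢ φ for φ with free variables
-- among Fin n (implicitly universally quantified).

Theory : Set₁
Theory = Formula 0 → Set

data _⊢_ (T : Theory) : {n : ℕ} → Formula n → Set where
  ax      : ∀ {n} {ψ : Formula 0} → T ψ → T ⊢ emb {n} ψ
  ax-K    : ∀ {n} {φ ψ : Formula n} → T ⊢ (φ ⇒ ψ ⇒ φ)
  ax-S    : ∀ {n} {φ ψ χ : Formula n} →
            T ⊢ ((φ ⇒ ψ ⇒ χ) ⇒ (φ ⇒ ψ) ⇒ φ ⇒ χ)
  ax-DN   : ∀ {n} {φ : Formula n} → T ⊢ (¬' (¬' φ) ⇒ φ)
  mp      : ∀ {n} {φ ψ : Formula n} → T ⊢ (φ ⇒ ψ) → T ⊢ φ → T ⊢ ψ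
  gen     : ∀ {n} {φ : Formula (suc n)} → T ⊢ φ → T ⊢ all φ
  ax-inst : ∀ {n} (φ : Formula (suc n)) (t : Term n) → T ⊢ (all φ ⇒ φ [ t ])
  ax-∀⇒   : ∀ {n} (ψ : Formula n) (φ : Formula (suc n)) →
            T ⊢ (all (wk ψ ⇒ φ) ⇒ ψ ⇒ all φ)
  ax-refl : ∀ {n} (t : Term n) → T ⊢ (t ≐ t)
  ax-eq   : ∀ {n} (φ : Formula (suc n)) (s t : Term n) →
            T ⊢ (s ≐ t ⇒ φ [ s ] ⇒ φ [ t ])

private
  x₀ : ∀ {n} → Term (suc n)
  x₀ = var zero
  x₁ : ∀ {n} → Term (suc (suc n))
  x₁ = var (suc zero)
  x₂ : ∀ {n} → Term (suc (suc (suc n)))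
  x₂ = var (suc (suc zero))

-- in 'all (all φ)', x₁ is the outer variable (x), x₀ the inner one (y)
data Q : Theory where
  Q1 : Q (all (¬' (S' x₀ ≐ zero')))
  Q2 : Q (all (all (S' x₁ ≐ S' x₀ ⇒ x₁ ≐ x₀)))
  Q3 : Q (all (¬' (x₀ ≐ zero') ⇒ ex (x₁ ≐ S' x₀)))
  Q4 : Q (all (x₀ +' zero' ≐ x₀))
  Q5 : Q (all (all (x₁ +' S' x₀ ≐ S' (x₁ +' x₀))))
  Q6 : Q (all (x₀ ·' zero' ≐ zero'))
  Q7 : Q (all (all (x₁ ·' S' x₀ ≐ (x₁ ·' x₀) +' x₁)))
  Q8 : Q (all (all ((x₁ ≼ x₀) ⇔ ex ((x₀ +' x₂) ≐ x₁))))

-- Induction schemata.  φ : Formula (suc k): variable zero is the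
-- induction variable, the other k variables are parameters; the axiom
-- is the universal closure of  φ(0) ∧ ∀x (φ(x) → φ(Sx)) → ∀x φ(x).

succSub : ∀ {k} → Sub (suc k) (suc k)
succSub zero    = S' (var zero)
succSub (suc i) = var (suc i)

ind : ∀ {k} → Formula (suc k) → Formula 0
ind {k} φ = close k ((φ [ zero' ] ∧' all (φ ⇒ subF succSub φ)) ⇒ all φ)

data I≤ : Theory where
  q   : ∀ {ψ} → Q ψ → I≤ ψ
  ind≤ : ∀ k (t s : Term (suc k)) → I≤ (ind (t ≼ s))

data I= : Theory where
  q   : ∀ {ψ} → Q ψ → I= ψ
  ind= : ∀ k (t s : Term (suc k)) → I= (ind (t ≐ s))

data I≠ : Theory where
  q   : ∀ {ψ} → Q ψ → I≠ ψ
  ind≠ : ∀ k (t s : Term (suc k)) → I≠ (ind (¬' (t ≐ s)))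

data I≰ : Theory where
  q   : ∀ {ψ} → Q ψ → I≰ ψ
  ind≰ : ∀ k (t s : Term (suc k)) → I≰ (ind (¬' (t ≼ s)))

_⊢all_ : Theory → Theory → Set
T ⊢all T' = ∀ {ψ} → T' ψ → T ⊢ ψ

{-# OPTIONS --safe #-}
-- Counter-model: ℕ extended by two points ω false, ω true above every number,
-- each fixed by S; a sum or product with a nonstandard argument is its leftmost
-- nonstandard argument, except that 0 · ω c = ω c · 0 = 0.  Then
-- ω false + ω true ≠ ω true + ω false, likewise for ·, and S (ω c) = ω c, while the
-- axioms of Q hold by inspection.
--
-- Induction for t(x) ≤ s(x) holds: at standard x it is ordinary induction.  For
-- x = ω c, the value of a term at ω c is approximated by its value at a large number
-- N (a standard value is unchanged, a nonstandard one becomes ≥ N).  Everything is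
-- ≤ a nonstandard point, and if s(ω c) is a number m then t(ω c) ≤ m is read off
-- from t(m+1) ≤ s(m+1) = m.
-- The formulas x + ω false = ω false, S x ≠ x and S x ≰ x hold at 0 and are
-- preserved by S, yet fail at a nonstandard point.
module Submission where

open import Data.Bool using (Bool; true; false)
import Data.Bool.Properties as Bool
open import Data.Empty using (⊥)
open import Data.Fin using (zero; suc)
open import Data.Nat using (ℕ; zero; suc; _+_; _*_; _≤_; z≤n; s≤s; s≤s⁻¹)
import Data.Nat.Properties as ℕ
open import Data.Product using (_×_; _,_; Σ-syntax)
open import Data.Vec.Functional using (Vector; []; _∷_; head; tail)
open import Function.Base using (_∘′_)
open import Function.Bundles using (_⇔_; mk⇔; module Equivalence)
open import Function.Related.TypeIsomorphisms using (→-cong-⇔)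
import Function.Construct.Identity as Identity
open import Relation.Binary.Definitions using (Decidable; DecidableEquality)
open import Relation.Binary.PropositionalEquality
  using (_≡_; _≢_; refl; sym; trans; cong; cong₂; subst; subst₂; _≗_)
open import Relation.Nullary using (¬_; yes; no)
open import Relation.Nullary.Decidable using (map′; decidable-stable)
open import Relation.Nullary.Negation using (Stable; contradiction)

open import Defs hiding (_⇔_)

open Equivalence using (to; from)

-- Decidable atoms make the Tarskian semantics below validate double negation.
record Structure : Set₁ where
  field
    Carrier   : Set
    0ˢ        : Carrier
    sucˢ      : Carrier → Carrier
    _+ˢ_ _*ˢ_ : Carrier → Carrier → Carrier
    _≤ˢ_      : Carrier → Carrier → Set
    _≟ˢ_      : DecidableEquality Carrier
    _≤?ˢ_     : Decidable _≤ˢ_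

∀-cong-⇔ : {A : Set} {B C : A → Set} → (∀ a → B a ⇔ C a) → (∀ a → B a) ⇔ (∀ a → C a)
∀-cong-⇔ B⇔C = mk⇔ (λ f a → to (B⇔C a) (f a)) (λ f a → from (B⇔C a) (f a))

subst₂-⇔ : {A : Set} (R : A → A → Set) {x x' y y' : A} → x ≡ x' → y ≡ y' → R x y ⇔ R x' y'
subst₂-⇔ R x≡x' y≡y' = mk⇔ (subst₂ R x≡x' y≡y') (subst₂ R (sym x≡x') (sym y≡y'))

module Semantics (𝔐 : Structure) where
  open Structure 𝔐

  Env : ℕ → Set
  Env = Vector Carrier

  ⟦_⟧ₜ : ∀ {k} → Term k → Env k → Carrier
  ⟦ var i ⟧ₜ  ρ = ρ i
  ⟦ zero' ⟧ₜ  ρ = 0ˢ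
  ⟦ S' t ⟧ₜ   ρ = sucˢ (⟦ t ⟧ₜ ρ)
  ⟦ t +' s ⟧ₜ ρ = ⟦ t ⟧ₜ ρ +ˢ ⟦ s ⟧ₜ ρ
  ⟦ t ·' s ⟧ₜ ρ = ⟦ t ⟧ₜ ρ *ˢ ⟦ s ⟧ₜ ρ

  ⟦_⟧ : ∀ {k} → Formula k → Env k → Set
  ⟦ t ≐ s ⟧ ρ = ⟦ t ⟧ₜ ρ ≡ ⟦ s ⟧ₜ ρ
  ⟦ t ≼ s ⟧ ρ = ⟦ t ⟧ₜ ρ ≤ˢ ⟦ s ⟧ₜ ρ
  ⟦ ⊥' ⟧    ρ = ⊥
  ⟦ φ ⇒ ψ ⟧ ρ = ⟦ φ ⟧ ρ → ⟦ ψ ⟧ ρ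
  ⟦ all φ ⟧ ρ = ∀ d → ⟦ φ ⟧ (d ∷ ρ)

  ⟦⟧-stable : ∀ {k} (φ : Formula k) ρ → Stable (⟦ φ ⟧ ρ)
  ⟦⟧-stable (t ≐ s) ρ = decidable-stable (⟦ t ⟧ₜ ρ ≟ˢ ⟦ s ⟧ₜ ρ)
  ⟦⟧-stable (t ≼ s) ρ = decidable-stable (⟦ t ⟧ₜ ρ ≤?ˢ ⟦ s ⟧ₜ ρ)
  ⟦⟧-stable ⊥'      ρ ¬¬⊥  = ¬¬⊥ λ ()
  ⟦⟧-stable (φ ⇒ ψ) ρ ¬¬φ⇒ψ x = ⟦⟧-stable ψ ρ λ ¬ψ → ¬¬φ⇒ψ λ f → ¬ψ (f x)
  ⟦⟧-stable (all φ) ρ ¬¬∀φ d = ⟦⟧-stable φ (d ∷ ρ) λ ¬φ → ¬¬∀φ λ f → ¬φ (f d)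

  ⟦∧'⟧ : ∀ {k} (φ ψ : Formula k) ρ → ⟦ φ ∧' ψ ⟧ ρ ⇔ (⟦ φ ⟧ ρ × ⟦ ψ ⟧ ρ)
  ⟦∧'⟧ φ ψ ρ = mk⇔
    (λ ¬¬φ∧ψ → ⟦⟧-stable φ ρ (λ ¬φ → ¬¬φ∧ψ λ x _ → ¬φ x)
             , ⟦⟧-stable ψ ρ (λ ¬ψ → ¬¬φ∧ψ λ _ y → ¬ψ y))
    (λ { (x , y) k → k x y })

  ⟦⟧ₜ-cong : ∀ {k} (t : Term k) {ρ ρ' : Env k} → ρ ≗ ρ' → ⟦ t ⟧ₜ ρ ≡ ⟦ t ⟧ₜ ρ'
  ⟦⟧ₜ-cong (var i)  ρ≗ρ' = ρ≗ρ' i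
  ⟦⟧ₜ-cong zero'    ρ≗ρ' = refl
  ⟦⟧ₜ-cong (S' t)   ρ≗ρ' = cong sucˢ (⟦⟧ₜ-cong t ρ≗ρ')
  ⟦⟧ₜ-cong (t +' s) ρ≗ρ' = cong₂ _+ˢ_ (⟦⟧ₜ-cong t ρ≗ρ') (⟦⟧ₜ-cong s ρ≗ρ')
  ⟦⟧ₜ-cong (t ·' s) ρ≗ρ' = cong₂ _*ˢ_ (⟦⟧ₜ-cong t ρ≗ρ') (⟦⟧ₜ-cong s ρ≗ρ')

  ∷-cong : ∀ {k} {ρ ρ' : Env k} d → ρ ≗ ρ' → (d ∷ ρ) ≗ (d ∷ ρ')
  ∷-cong d ρ≗ρ' zero    = refl
  ∷-cong d ρ≗ρ' (suc i) = ρ≗ρ' i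

  ⟦⟧-cong : ∀ {k} (φ : Formula k) {ρ ρ' : Env k} → ρ ≗ ρ' → ⟦ φ ⟧ ρ ⇔ ⟦ φ ⟧ ρ'
  ⟦⟧-cong (t ≐ s) ρ≗ρ' = subst₂-⇔ _≡_ (⟦⟧ₜ-cong t ρ≗ρ') (⟦⟧ₜ-cong s ρ≗ρ')
  ⟦⟧-cong (t ≼ s) ρ≗ρ' = subst₂-⇔ _≤ˢ_ (⟦⟧ₜ-cong t ρ≗ρ') (⟦⟧ₜ-cong s ρ≗ρ')
  ⟦⟧-cong ⊥'      ρ≗ρ' = Identity.⇔-id ⊥
  ⟦⟧-cong (φ ⇒ ψ) ρ≗ρ' = →-cong-⇔ (⟦⟧-cong φ ρ≗ρ') (⟦⟧-cong ψ ρ≗ρ')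
  ⟦⟧-cong (all φ) ρ≗ρ' = ∀-cong-⇔ λ d → ⟦⟧-cong φ (∷-cong d ρ≗ρ')

  ⟦renT⟧ : ∀ {k m} {r : Ren k m} {ρ : Env k} {ρ' : Env m} →
           (∀ i → ρ' (r i) ≡ ρ i) → ∀ t → ⟦ renT r t ⟧ₜ ρ' ≡ ⟦ t ⟧ₜ ρ
  ⟦renT⟧ h (var i)  = h i
  ⟦renT⟧ h zero'    = refl
  ⟦renT⟧ h (S' t)   = cong sucˢ (⟦renT⟧ h t)
  ⟦renT⟧ h (t +' s) = cong₂ _+ˢ_ (⟦renT⟧ h t) (⟦renT⟧ h s)
  ⟦renT⟧ h (t ·' s) = cong₂ _*ˢ_ (⟦renT⟧ h t) (⟦renT⟧ h s)

  ⟦renF⟧ : ∀ {k m} {r : Ren k m} {ρ : Env k} {ρ' : Env m} →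
           (∀ i → ρ' (r i) ≡ ρ i) → ∀ φ → ⟦ renF r φ ⟧ ρ' ⇔ ⟦ φ ⟧ ρ
  ⟦renF⟧ h (t ≐ s) = subst₂-⇔ _≡_ (⟦renT⟧ h t) (⟦renT⟧ h s)
  ⟦renF⟧ h (t ≼ s) = subst₂-⇔ _≤ˢ_ (⟦renT⟧ h t) (⟦renT⟧ h s)
  ⟦renF⟧ h ⊥'      = Identity.⇔-id ⊥
  ⟦renF⟧ h (φ ⇒ ψ) = →-cong-⇔ (⟦renF⟧ h φ) (⟦renF⟧ h ψ)
  ⟦renF⟧ h (all φ) = ∀-cong-⇔ λ d → ⟦renF⟧ (lift d) φ
    where
    lift : ∀ d i → (d ∷ _) (liftRen _ i) ≡ (d ∷ _) i
    lift d zero    = refl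
    lift d (suc i) = h i

  ⟦subT⟧ : ∀ {k m} {σ : Sub k m} {ρ : Env k} {ρ' : Env m} →
           (∀ i → ⟦ σ i ⟧ₜ ρ' ≡ ρ i) → ∀ t → ⟦ subT σ t ⟧ₜ ρ' ≡ ⟦ t ⟧ₜ ρ
  ⟦subT⟧ h (var i)  = h i
  ⟦subT⟧ h zero'    = refl
  ⟦subT⟧ h (S' t)   = cong sucˢ (⟦subT⟧ h t)
  ⟦subT⟧ h (t +' s) = cong₂ _+ˢ_ (⟦subT⟧ h t) (⟦subT⟧ h s)
  ⟦subT⟧ h (t ·' s) = cong₂ _*ˢ_ (⟦subT⟧ h t) (⟦subT⟧ h s)

  ⟦subF⟧ : ∀ {k m} {σ : Sub k m} {ρ : Env k} {ρ' : Env m} →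
           (∀ i → ⟦ σ i ⟧ₜ ρ' ≡ ρ i) → ∀ φ → ⟦ subF σ φ ⟧ ρ' ⇔ ⟦ φ ⟧ ρ
  ⟦subF⟧ h (t ≐ s) = subst₂-⇔ _≡_ (⟦subT⟧ h t) (⟦subT⟧ h s)
  ⟦subF⟧ h (t ≼ s) = subst₂-⇔ _≤ˢ_ (⟦subT⟧ h t) (⟦subT⟧ h s)
  ⟦subF⟧ h ⊥'      = Identity.⇔-id ⊥
  ⟦subF⟧ h (φ ⇒ ψ) = →-cong-⇔ (⟦subF⟧ h φ) (⟦subF⟧ h ψ)
  ⟦subF⟧ {σ = σ} h (all φ) = ∀-cong-⇔ λ d → ⟦subF⟧ (lift d) φ
    where
    lift : ∀ d i → ⟦ liftSub σ i ⟧ₜ (d ∷ _) ≡ (d ∷ _) i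
    lift d zero    = refl
    lift d (suc i) = trans (⟦renT⟧ (λ _ → refl) (σ i)) (h i)

  ⟦[]⟧ : ∀ {k} (φ : Formula (suc k)) t ρ → ⟦ φ [ t ] ⟧ ρ ⇔ ⟦ φ ⟧ (⟦ t ⟧ₜ ρ ∷ ρ)
  ⟦[]⟧ φ t ρ = ⟦subF⟧ σ₀-value φ
    where
    σ₀-value : ∀ i → ⟦ σ₀ t i ⟧ₜ ρ ≡ (⟦ t ⟧ₜ ρ ∷ ρ) i
    σ₀-value zero    = refl
    σ₀-value (suc i) = refl

  ⟦close⟧ : ∀ k (φ : Formula k) → ⟦ close k φ ⟧ [] ⇔ (∀ ρ → ⟦ φ ⟧ ρ)
  ⟦close⟧ zero    φ = mk⇔ (λ x ρ → to (⟦⟧-cong φ λ ()) x) (λ f → f [])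
  ⟦close⟧ (suc k) φ = mk⇔
    (λ c ρ → to (⟦⟧-cong φ head∷tail) (to (⟦close⟧ k (all φ)) c (tail ρ) (head ρ)))
    (λ f → from (⟦close⟧ k (all φ)) λ ρ d → f (d ∷ ρ))
    where
    head∷tail : ∀ {ρ : Env (suc k)} → (head ρ ∷ tail ρ) ≗ ρ
    head∷tail zero    = refl
    head∷tail (suc i) = refl

  InductionHolds : ∀ {k} → Formula (suc k) → Set
  InductionHolds φ = ∀ ρ → ⟦ φ ⟧ (0ˢ ∷ ρ) → (∀ d → ⟦ φ ⟧ (d ∷ ρ) → ⟦ φ ⟧ (sucˢ d ∷ ρ)) →
                     ∀ d → ⟦ φ ⟧ (d ∷ ρ)

  ⟦ind⟧ : ∀ {k} (φ : Formula (suc k)) → ⟦ ind φ ⟧ [] ⇔ InductionHolds φ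
  ⟦ind⟧ {k} φ = mk⇔
    (λ h ρ base step → to (⟦close⟧ k _) h ρ
       (from (⟦∧'⟧ (φ [ zero' ]) step-formula ρ)
         (from (⟦[]⟧ φ zero' ρ) base , λ d → from (⟦succ⟧ d) ∘′ step d)))
    (λ h → from (⟦close⟧ k _) λ ρ premise d →
       let base , step = to (⟦∧'⟧ (φ [ zero' ]) step-formula ρ) premise
       in h ρ (to (⟦[]⟧ φ zero' ρ) base) (λ d' → to (⟦succ⟧ d') ∘′ step d') d)
    where
    step-formula : Formula k
    step-formula = all (φ ⇒ subF succSub φ)
    ⟦succ⟧ : ∀ {ρ} d → ⟦ subF succSub φ ⟧ (d ∷ ρ) ⇔ ⟦ φ ⟧ (sucˢ d ∷ ρ)
    ⟦succ⟧ d = ⟦subF⟧ succSub-value φ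
      where
      succSub-value : ∀ i → ⟦ succSub i ⟧ₜ (d ∷ _) ≡ (sucˢ d ∷ _) i
      succSub-value zero    = refl
      succSub-value (suc i) = refl

  Satisfies : Theory → Set
  Satisfies T = ∀ {ψ} → T ψ → ⟦ ψ ⟧ []

  sound : ∀ {T} → Satisfies T → ∀ {k} {φ : Formula k} → T ⊢ φ → ∀ ρ → ⟦ φ ⟧ ρ
  sound ⊨T (ax {ψ = ψ} Tψ)     ρ = from (⟦renF⟧ (λ ()) ψ) (⊨T Tψ)
  sound ⊨T ax-K                ρ = λ x _ → x
  sound ⊨T ax-S                ρ = λ f g x → f x (g x)
  sound ⊨T (ax-DN {φ = φ})     ρ = ⟦⟧-stable φ ρ
  sound ⊨T (mp ⊢φ⇒ψ ⊢φ)        ρ = sound ⊨T ⊢φ⇒ψ ρ (sound ⊨T ⊢φ ρ)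
  sound ⊨T (gen ⊢φ)            ρ = λ d → sound ⊨T ⊢φ (d ∷ ρ)
  sound ⊨T (ax-inst φ t)       ρ = λ ∀φ → from (⟦[]⟧ φ t ρ) (∀φ (⟦ t ⟧ₜ ρ))
  sound ⊨T (ax-∀⇒ ψ φ)         ρ = λ ∀ψ⇒φ x d → ∀ψ⇒φ d (from (⟦renF⟧ (λ _ → refl) ψ) x)
  sound ⊨T (ax-refl t)         ρ = refl
  sound ⊨T (ax-eq φ s t)       ρ = λ s≡t φs →
    from (⟦[]⟧ φ t ρ) (subst (λ d → ⟦ φ ⟧ (d ∷ ρ)) s≡t (to (⟦[]⟧ φ s ρ) φs))

  unprovable : ∀ {T k} {φ : Formula k} → Satisfies T → (ρ : Env k) → ¬ ⟦ φ ⟧ ρ → ¬ (T ⊢ φ)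
  unprovable ⊨T ρ ¬φ ⊢φ = ¬φ (sound ⊨T ⊢φ ρ)

  induction-unprovable : ∀ {T T' k} {φ : Formula (suc k)} → Satisfies T → T' (ind φ) →
                         ¬ InductionHolds φ → ¬ (T ⊢all T')
  induction-unprovable {φ = φ} ⊨T T'indφ ¬ind ⊢T' =
    ¬ind (to (⟦ind⟧ φ) (sound ⊨T (⊢T' T'indφ) []))

data M : Set where
  nat : ℕ → M
  ω   : Bool → M

infixl 7 _*ᴹ_
infixl 6 _+ᴹ_
infix  4 _≤ᴹ_

sucᴹ : M → M
sucᴹ (nat n) = nat (suc n)
sucᴹ (ω c)   = ω c

_+ᴹ_ : M → M → M
nat m +ᴹ nat n = nat (m + n)
nat m +ᴹ ω c   = ω c
ω c   +ᴹ y     = ω c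

_*ᴹ_ : M → M → M
nat m       *ᴹ nat n       = nat (m * n)
nat zero    *ᴹ ω c         = nat 0
nat (suc m) *ᴹ ω c         = ω c
ω c         *ᴹ nat zero    = nat 0
ω c         *ᴹ nat (suc n) = ω c
ω c         *ᴹ ω d         = ω c

data _≤ᴹ_ : M → M → Set where
  nat≤nat : ∀ {m n} → m ≤ n → nat m ≤ᴹ nat n
  ≤ω      : ∀ {x c} → x ≤ᴹ ω c

_≟ᴹ_ : DecidableEquality M
nat m ≟ᴹ nat n = map′ (cong nat) (λ { refl → refl }) (m ℕ.≟ n)
nat m ≟ᴹ ω c   = no λ ()
ω c   ≟ᴹ nat n = no λ ()
ω c   ≟ᴹ ω d   = map′ (cong ω) (λ { refl → refl }) (c Bool.≟ d)

_≤?ᴹ_ : Decidable _≤ᴹ_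
nat m ≤?ᴹ nat n = map′ nat≤nat (λ { (nat≤nat m≤n) → m≤n }) (m ℕ.≤? n)
x     ≤?ᴹ ω c   = yes ≤ω
ω c   ≤?ᴹ nat n = no λ ()

𝕄 : Structure
𝕄 = record
  { Carrier = M ; 0ˢ = nat 0 ; sucˢ = sucᴹ ; _+ˢ_ = _+ᴹ_ ; _*ˢ_ = _*ᴹ_
  ; _≤ˢ_ = _≤ᴹ_ ; _≟ˢ_ = _≟ᴹ_ ; _≤?ˢ_ = _≤?ᴹ_ }

open Semantics 𝕄

sucᴹ-injective : ∀ x y → sucᴹ x ≡ sucᴹ y → x ≡ y
sucᴹ-injective (nat m) (nat n) refl = refl
sucᴹ-injective (ω c)   (ω d)   refl = refl

+ᴹ-identityʳ : ∀ x → x +ᴹ nat 0 ≡ x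
+ᴹ-identityʳ (nat m) = cong nat (ℕ.+-identityʳ m)
+ᴹ-identityʳ (ω c)   = refl

+ᴹ-suc : ∀ x y → x +ᴹ sucᴹ y ≡ sucᴹ (x +ᴹ y)
+ᴹ-suc (nat m) (nat n) = cong nat (ℕ.+-suc m n)
+ᴹ-suc (nat m) (ω c)   = refl
+ᴹ-suc (ω c)   y       = refl

*ᴹ-zeroʳ : ∀ x → x *ᴹ nat 0 ≡ nat 0
*ᴹ-zeroʳ (nat m) = cong nat (ℕ.*-zeroʳ m)
*ᴹ-zeroʳ (ω c)   = refl

*ᴹ-suc : ∀ x y → x *ᴹ sucᴹ y ≡ (x *ᴹ y) +ᴹ x
*ᴹ-suc (nat m)       (nat n)       = cong nat (trans (ℕ.*-suc m n) (ℕ.+-comm m (m * n)))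
*ᴹ-suc (nat zero)    (ω c)         = refl
*ᴹ-suc (nat (suc m)) (ω c)         = refl
*ᴹ-suc (ω c)         (nat zero)    = refl
*ᴹ-suc (ω c)         (nat (suc n)) = refl
*ᴹ-suc (ω c)         (ω d)         = refl

≤ᴹ⇒∃+ᴹ : ∀ {x y} → x ≤ᴹ y → Σ[ r ∈ M ] r +ᴹ x ≡ y
≤ᴹ⇒∃+ᴹ (nat≤nat m≤n) = nat _ , cong nat (ℕ.m∸n+n≡m m≤n)
≤ᴹ⇒∃+ᴹ {y = ω c} ≤ω = ω c , refl

+ᴹ≡⇒≤ᴹ : ∀ r x {y} → r +ᴹ x ≡ y → x ≤ᴹ y
+ᴹ≡⇒≤ᴹ (nat i) (nat j) refl = nat≤nat (ℕ.m≤n+m j i)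
+ᴹ≡⇒≤ᴹ (nat i) (ω c)   refl = ≤ω
+ᴹ≡⇒≤ᴹ (ω c)   x       refl = ≤ω

𝕄⊨Q : Satisfies Q
𝕄⊨Q Q1 (nat n) ()
𝕄⊨Q Q1 (ω c)   ()
𝕄⊨Q Q2 = sucᴹ-injective
𝕄⊨Q Q3 (nat zero)    x≢0 _   = x≢0 refl
𝕄⊨Q Q3 (nat (suc n)) _ ¬pred = ¬pred (nat n) refl
𝕄⊨Q Q3 (ω c)         _ ¬pred = ¬pred (ω c) refl
𝕄⊨Q Q4 = +ᴹ-identityʳ
𝕄⊨Q Q5 = +ᴹ-suc
𝕄⊨Q Q6 = *ᴹ-zeroʳ
𝕄⊨Q Q7 = *ᴹ-suc
𝕄⊨Q Q8 x y k = k
  (λ x≤y ∄r → let r , r+x≡y = ≤ᴹ⇒∃+ᴹ x≤y in ∄r r r+x≡y)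
  (λ ¬∄r → decidable-stable (x ≤?ᴹ y) λ x≰y → ¬∄r λ r r+x≡y → x≰y (+ᴹ≡⇒≤ᴹ r x r+x≡y))

0≤ᴹ : ∀ x → nat 0 ≤ᴹ x
0≤ᴹ (nat n) = nat≤nat z≤n
0≤ᴹ (ω c)   = ≤ω

≤ᴹ-trans : ∀ {x y z} → x ≤ᴹ y → y ≤ᴹ z → x ≤ᴹ z
≤ᴹ-trans (nat≤nat m≤n) (nat≤nat n≤o) = nat≤nat (ℕ.≤-trans m≤n n≤o)
≤ᴹ-trans _             ≤ω            = ≤ω

≤ᴹ-sucᴹ : ∀ {N y} → nat N ≤ᴹ y → nat N ≤ᴹ sucᴹ y
≤ᴹ-sucᴹ (nat≤nat N≤n) = nat≤nat (ℕ.m≤n⇒m≤1+n N≤n)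
≤ᴹ-sucᴹ ≤ω            = ≤ω

≤ᴹ-+ᴹˡ : ∀ {N x} y → nat N ≤ᴹ x → nat N ≤ᴹ x +ᴹ y
≤ᴹ-+ᴹˡ (nat n) (nat≤nat N≤m) = nat≤nat (ℕ.m≤n⇒m≤n+o n N≤m)
≤ᴹ-+ᴹˡ (ω c)   (nat≤nat N≤m) = ≤ω
≤ᴹ-+ᴹˡ y       ≤ω            = ≤ω

≤ᴹ-+ᴹʳ : ∀ {N y} x → nat N ≤ᴹ y → nat N ≤ᴹ x +ᴹ y
≤ᴹ-+ᴹʳ (nat m) (nat≤nat N≤n) = nat≤nat (ℕ.m≤n⇒m≤o+n m N≤n)
≤ᴹ-+ᴹʳ (nat m) ≤ω            = ≤ω
≤ᴹ-+ᴹʳ (ω c)   _             = ≤ω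

≤ᴹ-*ᴹˡ : ∀ {N x y} → nat N ≤ᴹ x → nat 1 ≤ᴹ y → nat N ≤ᴹ x *ᴹ y
≤ᴹ-*ᴹˡ (nat≤nat N≤m) (nat≤nat {n = suc n} _) = nat≤nat (ℕ.m≤n⇒m≤n*o (suc n) N≤m)
≤ᴹ-*ᴹˡ {x = nat zero}    (nat≤nat N≤0) ≤ω = nat≤nat N≤0
≤ᴹ-*ᴹˡ {x = nat (suc m)} (nat≤nat _)   ≤ω = ≤ω
≤ᴹ-*ᴹˡ ≤ω (nat≤nat {n = suc n} _) = ≤ω
≤ᴹ-*ᴹˡ ≤ω ≤ω                      = ≤ω

≤ᴹ-*ᴹʳ : ∀ {N x y} → nat 1 ≤ᴹ x → nat N ≤ᴹ y → nat N ≤ᴹ x *ᴹ y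
≤ᴹ-*ᴹʳ (nat≤nat {n = suc m} _) (nat≤nat N≤n) = nat≤nat (ℕ.m≤n⇒m≤o*n (suc m) N≤n)
≤ᴹ-*ᴹʳ (nat≤nat {n = suc m} _) ≤ω            = ≤ω
≤ᴹ-*ᴹʳ {y = nat zero}    ≤ω (nat≤nat N≤0) = nat≤nat N≤0
≤ᴹ-*ᴹʳ {y = nat (suc n)} ≤ω (nat≤nat _)   = ≤ω
≤ᴹ-*ᴹʳ ≤ω ≤ω = ≤ω

data Approx (N : ℕ) : M → M → Set where
  std    : ∀ {n} → Approx N (nat n) (nat n)
  nonstd : ∀ {c y} → nat N ≤ᴹ y → Approx N (ω c) y

approx-refl : ∀ {N} x → Approx N x x
approx-refl (nat n) = std
approx-refl (ω c)   = nonstd ≤ω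

approx-sucᴹ : ∀ {N x x'} → Approx N x x' → Approx N (sucᴹ x) (sucᴹ x')
approx-sucᴹ std          = std
approx-sucᴹ (nonstd N≤x) = nonstd (≤ᴹ-sucᴹ N≤x)

approx-+ᴹ : ∀ {N x x' y y'} → Approx N x x' → Approx N y y' → Approx N (x +ᴹ y) (x' +ᴹ y')
approx-+ᴹ std               std          = std
approx-+ᴹ {x' = x'} std     (nonstd N≤y) = nonstd (≤ᴹ-+ᴹʳ x' N≤y)
approx-+ᴹ {y' = y'} (nonstd N≤x) _       = nonstd (≤ᴹ-+ᴹˡ y' N≤x)

approx-*ᴹ : ∀ {N x x' y y'} → Approx N x x' → Approx N y y' → Approx N (x *ᴹ y) (x' *ᴹ y')
approx-*ᴹ std std = std
approx-*ᴹ (std {zero})  (nonstd {y = nat n} _) = std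
approx-*ᴹ (std {zero})  (nonstd {y = ω c}   _) = std
approx-*ᴹ (std {suc m}) (nonstd N≤y) = nonstd (≤ᴹ-*ᴹʳ (nat≤nat (s≤s z≤n)) N≤y)
approx-*ᴹ {N} {x' = x'} (nonstd _) (std {zero}) =
  subst (Approx N (nat 0)) (sym (*ᴹ-zeroʳ x')) std
approx-*ᴹ (nonstd N≤x) (std {suc n}) = nonstd (≤ᴹ-*ᴹˡ N≤x (nat≤nat (s≤s z≤n)))
approx-*ᴹ {zero}  (nonstd _)   (nonstd _) = nonstd (0≤ᴹ _)
approx-*ᴹ {suc N} (nonstd N<x) (nonstd N≤y) =
  nonstd (≤ᴹ-*ᴹʳ (≤ᴹ-trans (nat≤nat (s≤s z≤n)) N<x) N≤y)

approx-⟦⟧ₜ : ∀ {N k} (t : Term k) {ρ ρ' : Env k} →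
             (∀ i → Approx N (ρ i) (ρ' i)) → Approx N (⟦ t ⟧ₜ ρ) (⟦ t ⟧ₜ ρ')
approx-⟦⟧ₜ (var i)  ρ≈ρ' = ρ≈ρ' i
approx-⟦⟧ₜ zero'    ρ≈ρ' = std
approx-⟦⟧ₜ (S' t)   ρ≈ρ' = approx-sucᴹ (approx-⟦⟧ₜ t ρ≈ρ')
approx-⟦⟧ₜ (t +' s) ρ≈ρ' = approx-+ᴹ (approx-⟦⟧ₜ t ρ≈ρ') (approx-⟦⟧ₜ s ρ≈ρ')
approx-⟦⟧ₜ (t ·' s) ρ≈ρ' = approx-*ᴹ (approx-⟦⟧ₜ t ρ≈ρ') (approx-⟦⟧ₜ s ρ≈ρ')

approx-reflects-≤ᴹ : ∀ {m x x' y'} → Approx (suc m) x x' → Approx (suc m) (nat m) y' →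
                     x' ≤ᴹ y' → x ≤ᴹ nat m
approx-reflects-≤ᴹ std          std x'≤m = x'≤m
approx-reflects-≤ᴹ (nonstd m<x) std x'≤m with ≤ᴹ-trans m<x x'≤m
... | nat≤nat m<m = contradiction m<m (ℕ.1+n≰n)

approx-≤ᴹ : ∀ {x y} (f g : ℕ → M) → (∀ N → Approx N x (f N)) → (∀ N → Approx N y (g N)) →
            (∀ N → f N ≤ᴹ g N) → x ≤ᴹ y
approx-≤ᴹ {y = ω c}   f g x≈f y≈g f≤g = ≤ω
approx-≤ᴹ {y = nat m} f g x≈f y≈g f≤g =
  approx-reflects-≤ᴹ (x≈f (suc m)) (y≈g (suc m)) (f≤g (suc m))

≼-induction : ∀ {k} (t s : Term (suc k)) → InductionHolds (t ≼ s)
≼-induction t s ρ base step = holds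
  where
  holds-nat : ∀ n → ⟦ t ≼ s ⟧ (nat n ∷ ρ)
  holds-nat zero    = base
  holds-nat (suc n) = step (nat n) (holds-nat n)

  approx-env : ∀ c N i → Approx N ((ω c ∷ ρ) i) ((nat N ∷ ρ) i)
  approx-env c N zero    = nonstd (nat≤nat ℕ.≤-refl)
  approx-env c N (suc i) = approx-refl (ρ i)

  holds : ∀ d → ⟦ t ≼ s ⟧ (d ∷ ρ)
  holds (nat n) = holds-nat n
  holds (ω c)   = approx-≤ᴹ (λ N → ⟦ t ⟧ₜ (nat N ∷ ρ)) (λ N → ⟦ s ⟧ₜ (nat N ∷ ρ))
    (λ N → approx-⟦⟧ₜ t (approx-env c N)) (λ N → approx-⟦⟧ₜ s (approx-env c N)) holds-nat

𝕄⊨I≤ : Satisfies I≤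
𝕄⊨I≤ (q Qψ)        = 𝕄⊨Q Qψ
𝕄⊨I≤ (ind≤ k t s) = from (⟦ind⟧ (t ≼ s)) (≼-induction t s)

induction-fails-x+y≐y : ¬ InductionHolds {1} (var zero +' var (suc zero) ≐ var (suc zero))
induction-fails-x+y≐y h = contradiction (h (ω false ∷ []) refl step (ω true)) λ ()
  where
  step : ∀ d → d +ᴹ ω false ≡ ω false → sucᴹ d +ᴹ ω false ≡ ω false
  step (nat n) _ = refl
  step (ω c)   e = e

induction-fails-Sx≠x : ¬ InductionHolds {0} (¬' (S' (var zero) ≐ var zero))
induction-fails-Sx≠x h = h [] (λ ()) step (ω false) refl
  where
  step : ∀ d → sucᴹ d ≢ d → sucᴹ (sucᴹ d) ≢ sucᴹ d
  step d Sd≢d SSd≡Sd = Sd≢d (sucᴹ-injective _ _ SSd≡Sd)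

induction-fails-Sx≰x : ¬ InductionHolds {0} (¬' (S' (var zero) ≼ var zero))
induction-fails-Sx≰x h = h [] (λ { (nat≤nat ()) }) step (ω false) ≤ω
  where
  step : ∀ d → ¬ sucᴹ d ≤ᴹ d → ¬ sucᴹ (sucᴹ d) ≤ᴹ sucᴹ d
  step (nat n) Sd≰d (nat≤nat SSn≤Sn) = Sd≰d (nat≤nat (s≤s⁻¹ SSn≤Sn))
  step (ω c)   Sd≰d _                = Sd≰d ≤ω

proposition3p4 :
    ( ¬ (_⊢_ I≤ {2} (var zero +' var (suc zero) ≐ var (suc zero) +' var zero))
    × ¬ (_⊢_ I≤ {2} (var zero ·' var (suc zero) ≐ var (suc zero) ·' var zero))
    × ¬ (_⊢_ I≤ {1} (¬' (S' (var zero) ≐ var zero))) )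
    ×
    ( ¬ (I≤ ⊢all I=)
    × ¬ (I≤ ⊢all I≠)
    × ¬ (I≤ ⊢all I≰) )
proposition3p4 =
  ( unprovable 𝕄⊨I≤ (ω false ∷ ω true ∷ []) (λ ())
  , unprovable 𝕄⊨I≤ (ω false ∷ ω true ∷ []) (λ ())
  , unprovable 𝕄⊨I≤ (ω false ∷ []) (λ ¬Sx≡x → ¬Sx≡x refl) )
  ,
  ( induction-unprovable 𝕄⊨I≤ (ind= 1 (var zero +' var (suc zero)) (var (suc zero)))
      induction-fails-x+y≐y
  , induction-unprovable 𝕄⊨I≤ (ind≠ 0 (S' (var zero)) (var zero)) induction-fails-Sx≠x
  , induction-unprovable 𝕄⊨I≤ (ind≰ 0 (S' (var zero)) (var zero)) induction-fails-Sx≰x )
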